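{- Let $H$ be a 3-uniform hypergraph such that every pair $p \in E(\partial H)$ is contained in at least one element of $\mathcal{K}_5(H)$. Then there exists $w\colon E(H) \to \mathbb{R}$ such that $\deg^w(p) = 1$ for all pairs $p \in E(\partial H)$.
   Context: $\mathcal{K}_5(H)$ is the set of 5-vertex sets $K\subseteq V(H)$ all of whose 3-element subsets are edges of $H$. $\partial H$ is the graph on $V(H)$ whose edges are the pairs of vertices contained in at least one edge of $H$. For $w\colon E(H)\to\mathbb{R}$ and a pair $p$, $\deg^w(p) = \sum_{e\in E(H),\, p\subseteq e} w(e)$. -}

module Defs where

open import Data.Nat using (ℕ)
open import Data.Fin.Subset using (Subset; _⊆_; ∣_∣)
open import Data.Fin.Subset.Properties using (_⊆?_)
open import Data.List using (List; filter; map; foldr)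
open import Data.List.Membership.Propositional using (_∈_)
open import Data.List.Relation.Unary.All using (All)
open import Data.List.Relation.Unary.Unique.Propositional using (Unique)
open import Data.Product using (Σ; _×_; ∃-syntax)
open import Data.Rational using (ℚ; _+_; 0ℚ)
open import Relation.Binary.PropositionalEquality using (_≡_)

record Hypergraph3 (n : ℕ) : Set where
  field
    edges   : List (Subset n)
    uniform : All (λ e → ∣ e ∣ ≡ 3) edges
    unique  : Unique edges
open Hypergraph3 public

InShadow : ∀ {n} → Hypergraph3 n → Subset n → Set
InShadow H p = ∣ p ∣ ≡ 2 × ∃[ e ] (e ∈ edges H × p ⊆ e)

InK5 : ∀ {n} → Hypergraph3 n → Subset n → Set
InK5 H K = ∣ K ∣ ≡ 5 × (∀ T → T ⊆ K → ∣ T ∣ ≡ 3 → T ∈ edges H)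

sumℚ : List ℚ → ℚ
sumℚ = foldr _+_ 0ℚ

-- deg^w(p) = Σ_{e ∈ E(H), p ⊆ e} w(e). Weights are given as a function on
-- subsets; only its values on edges of H matter.
deg : ∀ {n} → Hypergraph3 n → (Subset n → ℚ) → Subset n → ℚ
deg H w p = sumℚ (map w (filter (p ⊆?_) (edges H)))

-- For every shadow pair p choose a copy K of K₅ containing it, and weight each 3-subset e of K
-- by 1/3, −1/6 or 1/3 according as e meets p in 0, 1 or 2 vertices.  Every pair q ⊆ K lies in
-- exactly three such 3-subsets, and the weights are chosen so that the degree of q is 1 if
-- q = p and 0 otherwise; pairs not inside K have degree 0.  Summing these weightings over all
-- shadow pairs therefore gives every shadow pair degree exactly 1.
module Submission where

open import Defs
open import Algebra.Bundles using (CommutativeMonoid)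
open import Data.Bool using (if_then_else_)
open import Data.Empty using (⊥-elim)
open import Data.Fin using (Fin; zero; suc)
open import Data.Fin.Properties using (0≢1+n; suc-injective)
open import Data.Fin.Subset
  using (Subset; _⊆_; _⊂_; ∣_∣; _∪_; _∩_; _─_; ⁅_⁆; ⊥; inside; outside)
  renaming (_∈_ to _∈ₛ_; _∉_ to _∉ₛ_)
open import Data.Fin.Subset.Properties
  using ( _⊆?_; _∈?_; drop-there; drop-∷-⊆; ⊆-antisym; p⊂q⇒∣p∣<∣q∣; Empty-unique
        ; x∈⁅x⁆; x∈⁅y⁆⇒x≡y; p⊆p∪q; x∈p∪q⁻; q⊆p∪q; p∩q⊆p; p∩q⊆q; x∈p∩q⁺; x∈p∩q⁻
        ; p─q⊆p; x∈p∧x∉q⇒x∈p─q; ∩-idem; ∩-distribˡ-∪; ∪-identityʳ)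
open import Data.List using (List; []; _∷_; map; filter)
open import Data.List.Membership.Propositional using (_∈_; find; lose)
open import Data.List.Membership.Propositional.Properties using (∈-filter⁺; ∈-filter⁻)
open import Data.List.Properties using (map-cong-local)
import Data.List.Relation.Unary.All as All
open import Data.List.Relation.Unary.Any using (any?; here; there)
open import Data.List.Relation.Unary.AllPairs using (_∷_)
open import Data.List.Relation.Unary.Unique.Propositional using (Unique)
open import Data.List.Relation.Unary.Unique.Propositional.Properties using (filter⁺)
open import Data.Nat as ℕ using (ℕ; zero; suc; _<_; s≤s)
import Data.Nat.Properties as ℕ
open import Data.Product using (_×_; _,_; proj₁; proj₂; ∃-syntax)
open import Data.Rational using (ℚ; 0ℚ; 1ℚ; _+_; -_; _/_)
import Data.Rational.Properties as ℚ
import Data.Integer as ℤ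
open import Data.Sum using ([_,_])
open import Data.Vec using ([]; _∷_; here; there)
open import Data.Vec.Properties using (∷-injectiveʳ; ≡-dec)
import Data.Bool.Properties as Bool
open import Function using (_∘_)
open import Relation.Binary.Definitions using (DecidableEquality)
open import Relation.Binary.PropositionalEquality
  using (_≡_; _≢_; refl; sym; trans; cong; cong₂; subst; module ≡-Reasoning)
open import Relation.Nullary using (¬_; Dec; yes; no; does)
open import Relation.Nullary.Decidable using (dec-true; dec-false; map′; _×-dec_)

open import Algebra.Properties.CommutativeSemigroup
  (CommutativeMonoid.commutativeSemigroup ℚ.+-0-commutativeMonoid)
  using (x∙yz≈y∙xz; interchange)
open import Algebra.Definitions.RawMonoid (CommutativeMonoid.rawMonoid ℚ.+-0-commutativeMonoid)
  using () renaming (_×_ to _·_)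

open ≡-Reasoning

private
  variable
    n : ℕ
    A : Set
    p q r e K : Subset n
    x : Fin n

sumℚ-zero : {F : A → ℚ} {L : List A} → (∀ {e} → e ∈ L → F e ≡ 0ℚ) → sumℚ (map F L) ≡ 0ℚ
sumℚ-zero {L = []}    F≡0 = refl
sumℚ-zero {L = _ ∷ _} F≡0 = cong₂ _+_ (F≡0 (here refl)) (sumℚ-zero (F≡0 ∘ there))

sumℚ-distrib-+ : (F G : A → ℚ) (L : List A) →
  sumℚ (map (λ e → F e + G e) L) ≡ sumℚ (map F L) + sumℚ (map G L)
sumℚ-distrib-+ F G []      = refl
sumℚ-distrib-+ F G (e ∷ L) =
  trans (cong ((F e + G e) +_) (sumℚ-distrib-+ F G L)) (interchange (F e) (G e) _ _)

sumOver : Subset n → (Fin n → ℚ) → ℚ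
sumOver []            f = 0ℚ
sumOver (inside  ∷ D) f = f zero + sumOver D (f ∘ suc)
sumOver (outside ∷ D) f = sumOver D (f ∘ suc)

sumOver-cong : (D : Subset n) {f g : Fin n → ℚ} → (∀ {x} → x ∈ₛ D → f x ≡ g x) →
  sumOver D f ≡ sumOver D g
sumOver-cong []            f≡g = refl
sumOver-cong (inside  ∷ D) f≡g = cong₂ _+_ (f≡g here) (sumOver-cong D (f≡g ∘ there))
sumOver-cong (outside ∷ D) f≡g = sumOver-cong D (f≡g ∘ there)

sumOver-two-valued : (D P : Subset n) {f : Fin n → ℚ} {a b : ℚ} →
  (∀ {x} → x ∈ₛ D → x ∈ₛ P → f x ≡ a) → (∀ {x} → x ∈ₛ D → x ∉ₛ P → f x ≡ b) →
  sumOver D f ≡ ∣ D ∩ P ∣ · a + ∣ D ─ P ∣ · b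
sumOver-two-valued []      []      on-P off-P = refl
sumOver-two-valued (_ ∷ D) (_ ∷ P) {f} on-P off-P
  with sumOver-two-valued D P {f ∘ suc} (λ x∈D → on-P (there x∈D) ∘ there)
                                        (λ x∈D x∉P → off-P (there x∈D) (x∉P ∘ drop-there))
sumOver-two-valued (outside ∷ D) (inside  ∷ P) on-P off-P | ih = ih
sumOver-two-valued (outside ∷ D) (outside ∷ P) on-P off-P | ih = ih
sumOver-two-valued (inside  ∷ D) (inside  ∷ P) {a = a} {b} on-P off-P | ih =
  trans (cong₂ _+_ (on-P here here) ih) (sym (ℚ.+-assoc a (∣ D ∩ P ∣ · a) (∣ D ─ P ∣ · b)))
sumOver-two-valued (inside  ∷ D) (outside ∷ P) {a = a} {b} on-P off-P | ih =
  trans (cong₂ _+_ (off-P here λ ()) ih) (x∙yz≈y∙xz b (∣ D ∩ P ∣ · a) (∣ D ─ P ∣ · b))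

module _ (_≟_ : DecidableEquality A) where

  private
    erase : A → (A → ℚ) → A → ℚ
    erase a F e = if does (e ≟ a) then 0ℚ else F e

    erase-self : ∀ {a} F → erase a F a ≡ 0ℚ
    erase-self {a} F = cong (if_then 0ℚ else F a) (dec-true (a ≟ a) refl)

    erase-≢ : ∀ {a e} F → e ≢ a → erase a F e ≡ F e
    erase-≢ {a} {e} F e≢a = cong (if_then 0ℚ else F e) (dec-false (e ≟ a) e≢a)

    sumℚ-extract : {F : A → ℚ} {a : A} {L : List A} → Unique L → a ∈ L →
      sumℚ (map F L) ≡ F a + sumℚ (map (erase a F) L)
    sumℚ-extract {F} {a} {_ ∷ L} (a∉L ∷ _) (here refl) = cong (F a +_) (begin
      sumℚ (map F L)                          ≡⟨ sym (ℚ.+-identityˡ _) ⟩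
      0ℚ + sumℚ (map F L)                     ≡⟨ cong₂ _+_ (sym (erase-self F)) (cong sumℚ (map-cong-local
                                                   (All.map (λ a≢e → sym (erase-≢ F (a≢e ∘ sym))) a∉L))) ⟩
      erase a F a + sumℚ (map (erase a F) L)  ∎)
    sumℚ-extract {F} {a} {b ∷ L} (b∉L ∷ L-unique) (there a∈L) = begin
      F b + sumℚ (map F L)                              ≡⟨ cong (F b +_) (sumℚ-extract L-unique a∈L) ⟩
      F b + (F a + sumℚ (map (erase a F) L))            ≡⟨ x∙yz≈y∙xz (F b) (F a) _ ⟩
      F a + (F b + sumℚ (map (erase a F) L))            ≡⟨ cong (λ t → F a + (t + _))
                                                             (sym (erase-≢ F (All.lookup b∉L a∈L))) ⟩
      F a + (erase a F b + sumℚ (map (erase a F) L))    ∎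

  sumℚ-reindex : (D : Subset n) (φ : Fin n → A) {F : A → ℚ} {L : List A} → Unique L →
    (∀ {x y} → x ∈ₛ D → y ∈ₛ D → φ x ≡ φ y → x ≡ y) →
    (∀ {x} → x ∈ₛ D → φ x ∈ L) →
    (∀ {e} → e ∈ L → (∀ {x} → x ∈ₛ D → e ≢ φ x) → F e ≡ 0ℚ) →
    sumℚ (map F L) ≡ sumOver D (F ∘ φ)
  sumℚ-reindex [] φ L-unique φ-inj φ∈L F-off = sumℚ-zero (λ e∈L → F-off e∈L λ ())
  sumℚ-reindex (outside ∷ D) φ L-unique φ-inj φ∈L F-off =
    sumℚ-reindex D (φ ∘ suc) L-unique
      (λ x∈D y∈D → suc-injective ∘ φ-inj (there x∈D) (there y∈D)) (φ∈L ∘ there)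
      (λ e∈L e∉φD → F-off e∈L λ { (there x∈D) → e∉φD x∈D })
  sumℚ-reindex (inside ∷ D) φ {F} {L} L-unique φ-inj φ∈L F-off = begin
    sumℚ (map F L)
      ≡⟨ sumℚ-extract L-unique (φ∈L here) ⟩
    F (φ zero) + sumℚ (map F′ L)
      ≡⟨ cong (F (φ zero) +_) (sumℚ-reindex D (φ ∘ suc) L-unique
           (λ x∈D y∈D → suc-injective ∘ φ-inj (there x∈D) (there y∈D)) (φ∈L ∘ there) F′-off) ⟩
    F (φ zero) + sumOver D (F′ ∘ φ ∘ suc)
      ≡⟨ cong (F (φ zero) +_) (sumOver-cong D λ x∈D → erase-≢ F (0≢1+n ∘ φ-inj here (there x∈D) ∘ sym)) ⟩
    F (φ zero) + sumOver D (F ∘ φ ∘ suc)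
      ∎
    where
    F′ : A → ℚ
    F′ = erase (φ zero) F

    F′-off : ∀ {e} → e ∈ L → (∀ {x} → x ∈ₛ D → e ≢ φ (suc x)) → F′ e ≡ 0ℚ
    F′-off {e} e∈L e∉φD with e ≟ φ zero
    ... | yes _    = refl
    ... | no  e≢φ0 = F-off e∈L λ { here → e≢φ0 ; (there x∈D) → e∉φD x∈D }

sumSubsets : (Subset n → ℚ) → ℚ
sumSubsets {zero}  F = F []
sumSubsets {suc n} F = sumSubsets (F ∘ (inside ∷_)) + sumSubsets (F ∘ (outside ∷_))

sumSubsets-zero : {F : Subset n → ℚ} → (∀ p → F p ≡ 0ℚ) → sumSubsets F ≡ 0ℚ
sumSubsets-zero {zero}  F≡0 = F≡0 []
sumSubsets-zero {suc n} F≡0 =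
  cong₂ _+_ (sumSubsets-zero (F≡0 ∘ (inside ∷_))) (sumSubsets-zero (F≡0 ∘ (outside ∷_)))

sumSubsets-single : (q : Subset n) {F : Subset n → ℚ} → (∀ p → p ≢ q → F p ≡ 0ℚ) → sumSubsets F ≡ F q
sumSubsets-single []            F-off = refl
sumSubsets-single (inside  ∷ q) F-off =
  trans (cong₂ _+_ (sumSubsets-single q λ p p≢q → F-off (inside ∷ p) (p≢q ∘ ∷-injectiveʳ))
                   (sumSubsets-zero λ p → F-off (outside ∷ p) λ ()))
        (ℚ.+-identityʳ _)
sumSubsets-single (outside ∷ q) F-off =
  trans (cong₂ _+_ (sumSubsets-zero λ p → F-off (inside ∷ p) λ ())
                   (sumSubsets-single q λ p p≢q → F-off (outside ∷ p) (p≢q ∘ ∷-injectiveʳ)))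
        (ℚ.+-identityˡ _)

sumℚ-sumSubsets-comm : (C : Subset n → A → ℚ) (L : List A) →
  sumℚ (map (λ e → sumSubsets (λ p → C p e)) L) ≡ sumSubsets (λ p → sumℚ (map (C p) L))
sumℚ-sumSubsets-comm {zero}  C L = refl
sumℚ-sumSubsets-comm {suc n} C L =
  trans (sumℚ-distrib-+ (λ e → sumSubsets (λ p → C (inside ∷ p) e))
                        (λ e → sumSubsets (λ p → C (outside ∷ p) e)) L)
        (cong₂ _+_ (sumℚ-sumSubsets-comm (C ∘ (inside ∷_)) L)
                   (sumℚ-sumSubsets-comm (C ∘ (outside ∷_)) L))

∪-⊆ : p ⊆ r → q ⊆ r → p ∪ q ⊆ r
∪-⊆ {p = p} {q = q} p⊆r q⊆r = [ p⊆r , q⊆r ] ∘ x∈p∪q⁻ p q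

x∈p⇒⁅x⁆⊆p : x ∈ₛ p → ⁅ x ⁆ ⊆ p
x∈p⇒⁅x⁆⊆p {x = x} {p = p} x∈p y∈⁅x⁆ = subst (_∈ₛ p) (sym (x∈⁅y⁆⇒x≡y x y∈⁅x⁆)) x∈p

q⊆p⇒p∩q≡q : q ⊆ p → p ∩ q ≡ q
q⊆p⇒p∩q≡q {q = q} {p = p} q⊆p = ⊆-antisym (p∩q⊆q p q) (λ x∈q → x∈p∩q⁺ (q⊆p x∈q , x∈q))

x∈p─q⇒x∉q : x ∈ₛ p ─ q → x ∉ₛ q
x∈p─q⇒x∉q {p = inside  ∷ p} {q = outside ∷ q} here         ()
x∈p─q⇒x∉q {p = _       ∷ p} {q = _       ∷ q} (there x∈p─q) (there x∈q) = x∈p─q⇒x∉q x∈p─q x∈q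

∣p∩q∣+∣p─q∣≡∣p∣ : ∀ (p q : Subset n) → ∣ p ∩ q ∣ ℕ.+ ∣ p ─ q ∣ ≡ ∣ p ∣
∣p∩q∣+∣p─q∣≡∣p∣ []            []            = refl
∣p∩q∣+∣p─q∣≡∣p∣ (inside  ∷ p) (inside  ∷ q) = cong suc (∣p∩q∣+∣p─q∣≡∣p∣ p q)
∣p∩q∣+∣p─q∣≡∣p∣ (inside  ∷ p) (outside ∷ q) = trans (ℕ.+-suc _ _) (cong suc (∣p∩q∣+∣p─q∣≡∣p∣ p q))
∣p∩q∣+∣p─q∣≡∣p∣ (outside ∷ p) (inside  ∷ q) = ∣p∩q∣+∣p─q∣≡∣p∣ p q
∣p∩q∣+∣p─q∣≡∣p∣ (outside ∷ p) (outside ∷ q) = ∣p∩q∣+∣p─q∣≡∣p∣ p q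

x∉p⇒∣p∪⁅x⁆∣≡1+∣p∣ : x ∉ₛ p → ∣ p ∪ ⁅ x ⁆ ∣ ≡ suc ∣ p ∣
x∉p⇒∣p∪⁅x⁆∣≡1+∣p∣ {x = zero}  {p = inside  ∷ p} x∉p = ⊥-elim (x∉p here)
x∉p⇒∣p∪⁅x⁆∣≡1+∣p∣ {x = zero}  {p = outside ∷ p} x∉p = cong (suc ∘ ∣_∣) (∪-identityʳ p)
x∉p⇒∣p∪⁅x⁆∣≡1+∣p∣ {x = suc x} {p = inside  ∷ p} x∉p = cong suc (x∉p⇒∣p∪⁅x⁆∣≡1+∣p∣ (x∉p ∘ there))
x∉p⇒∣p∪⁅x⁆∣≡1+∣p∣ {x = suc x} {p = outside ∷ p} x∉p = x∉p⇒∣p∪⁅x⁆∣≡1+∣p∣ (x∉p ∘ there)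

p⊆q∧∣p∣<∣q∣⇒p⊂q : p ⊆ q → ∣ p ∣ < ∣ q ∣ → p ⊂ q
p⊆q∧∣p∣<∣q∣⇒p⊂q {p = p} {q = q} p⊆q ∣p∣<∣q∣ = p⊆q , witness p q p⊆q ∣p∣<∣q∣
  where
  witness : ∀ {n} (p q : Subset n) → p ⊆ q → ∣ p ∣ < ∣ q ∣ → ∃[ x ] (x ∈ₛ q × x ∉ₛ p)
  witness (inside  ∷ p) (outside ∷ q) p⊆q _ with () ← p⊆q here
  witness (outside ∷ p) (inside  ∷ q) _   _ = zero , here , λ ()
  witness (inside  ∷ p) (inside  ∷ q) p⊆q (s≤s ∣p∣<∣q∣) with witness p q (drop-∷-⊆ p⊆q) ∣p∣<∣q∣
  ... | x , x∈q , x∉p = suc x , there x∈q , x∉p ∘ drop-there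
  witness (outside ∷ p) (outside ∷ q) p⊆q ∣p∣<∣q∣ with witness p q (drop-∷-⊆ p⊆q) ∣p∣<∣q∣
  ... | x , x∈q , x∉p = suc x , there x∈q , x∉p ∘ drop-there

p⊆q∧∣p∣≡∣q∣⇒p≡q : p ⊆ q → ∣ p ∣ ≡ ∣ q ∣ → p ≡ q
p⊆q∧∣p∣≡∣q∣⇒p≡q {p = p} {q = q} p⊆q ∣p∣≡∣q∣ = ⊆-antisym p⊆q q⊆p
  where
  q⊆p : q ⊆ p
  q⊆p {x} x∈q with x ∈? p
  ... | yes x∈p = x∈p
  ... | no  x∉p = ⊥-elim (ℕ.<-irrefl ∣p∣≡∣q∣ (p⊂q⇒∣p∣<∣q∣ (p⊆q , x , x∈q , x∉p)))

∪⁅⁆-⊆ : q ⊆ p → x ∈ₛ p → q ∪ ⁅ x ⁆ ⊆ p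
∪⁅⁆-⊆ q⊆p x∈p = ∪-⊆ q⊆p (x∈p⇒⁅x⁆⊆p x∈p)

p⊆q∧∣q∣≡1+∣p∣⇒q≡p∪⁅x⁆ : p ⊆ q → ∣ q ∣ ≡ suc ∣ p ∣ → ∃[ x ] (x ∉ₛ p × x ∈ₛ q × q ≡ p ∪ ⁅ x ⁆)
p⊆q∧∣q∣≡1+∣p∣⇒q≡p∪⁅x⁆ p⊆q ∣q∣≡1+∣p∣ with p⊆q∧∣p∣<∣q∣⇒p⊂q p⊆q (ℕ.≤-reflexive (sym ∣q∣≡1+∣p∣))
... | _ , x , x∈q , x∉p =
  x , x∉p , x∈q , sym (p⊆q∧∣p∣≡∣q∣⇒p≡q (∪⁅⁆-⊆ p⊆q x∈q) (trans (x∉p⇒∣p∪⁅x⁆∣≡1+∣p∣ x∉p) (sym ∣q∣≡1+∣p∣)))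

p⊆r⇒[r─q]∩p≡p─q : p ⊆ r → (r ─ q) ∩ p ≡ p ─ q
p⊆r⇒[r─q]∩p≡p─q {p = p} {r = r} {q = q} p⊆r = ⊆-antisym
  (λ x∈[r─q]∩p → let x∈r─q , x∈p = x∈p∩q⁻ (r ─ q) p x∈[r─q]∩p in x∈p∧x∉q⇒x∈p─q x∈p (x∈p─q⇒x∉q x∈r─q))
  (λ x∈p─q → let x∈p = p─q⊆p p q x∈p─q in x∈p∩q⁺ (x∈p∧x∉q⇒x∈p─q (p⊆r x∈p) (x∈p─q⇒x∉q x∈p─q) , x∈p))

x∈p∧x∉q⇒∣p∩[q∪⁅x⁆]∣≡1+∣p∩q∣ : x ∈ₛ p → x ∉ₛ q → ∣ p ∩ (q ∪ ⁅ x ⁆) ∣ ≡ suc ∣ p ∩ q ∣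
x∈p∧x∉q⇒∣p∩[q∪⁅x⁆]∣≡1+∣p∩q∣ {x = x} {p = p} {q = q} x∈p x∉q = begin
  ∣ p ∩ (q ∪ ⁅ x ⁆) ∣        ≡⟨ cong ∣_∣ (∩-distribˡ-∪ p q ⁅ x ⁆) ⟩
  ∣ (p ∩ q) ∪ (p ∩ ⁅ x ⁆) ∣  ≡⟨ cong (λ r → ∣ (p ∩ q) ∪ r ∣) (q⊆p⇒p∩q≡q (x∈p⇒⁅x⁆⊆p x∈p)) ⟩
  ∣ (p ∩ q) ∪ ⁅ x ⁆ ∣        ≡⟨ x∉p⇒∣p∪⁅x⁆∣≡1+∣p∣ (x∉q ∘ p∩q⊆q p q) ⟩
  suc ∣ p ∩ q ∣              ∎

x∉p⇒∣p∩[q∪⁅x⁆]∣≡∣p∩q∣ : x ∉ₛ p → ∣ p ∩ (q ∪ ⁅ x ⁆) ∣ ≡ ∣ p ∩ q ∣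
x∉p⇒∣p∩[q∪⁅x⁆]∣≡∣p∩q∣ {x = x} {p = p} {q = q} x∉p = begin
  ∣ p ∩ (q ∪ ⁅ x ⁆) ∣        ≡⟨ cong ∣_∣ (∩-distribˡ-∪ p q ⁅ x ⁆) ⟩
  ∣ (p ∩ q) ∪ (p ∩ ⁅ x ⁆) ∣  ≡⟨ cong (λ r → ∣ (p ∩ q) ∪ r ∣) p∩⁅x⁆≡⊥ ⟩
  ∣ (p ∩ q) ∪ ⊥ ∣            ≡⟨ cong ∣_∣ (∪-identityʳ (p ∩ q)) ⟩
  ∣ p ∩ q ∣                  ∎
  where
  p∩⁅x⁆≡⊥ : p ∩ ⁅ x ⁆ ≡ ⊥
  p∩⁅x⁆≡⊥ = Empty-unique λ (y , y∈p∩⁅x⁆) →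
    x∉p (subst (_∈ₛ p) (x∈⁅y⁆⇒x≡y x (p∩q⊆q p ⁅ x ⁆ y∈p∩⁅x⁆)) (p∩q⊆p p ⁅ x ⁆ y∈p∩⁅x⁆))

δ : ℕ → ℕ → ℚ
δ m n = if does (m ℕ.≟ n) then 1ℚ else 0ℚ

δ-≢ : ∀ {m n} → m ≢ n → δ m n ≡ 0ℚ
δ-≢ {m} {n} m≢n = cong (if_then 1ℚ else 0ℚ) (dec-false (m ℕ.≟ n) m≢n)

-- The three edges of a K₅ through a pair q are the q ∪ ⁅ x ⁆ with x ∉ q.  If a pair p meets q in
-- c vertices, 2 ∸ c of them meet p in 1 + c vertices and 1 + c of them in c, and these values solve
-- (2 ∸ c) · cliqueCoeff (1 + c) + (1 + c) · cliqueCoeff c = δ c 2 for c = 0, 1, 2.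
cliqueCoeff : ℕ → ℚ
cliqueCoeff 0 = ℤ.+ 1 / 3
cliqueCoeff 1 = - (ℤ.+ 1 / 6)
cliqueCoeff 2 = ℤ.+ 1 / 3
cliqueCoeff _ = 0ℚ

cliqueCoeff-balance : ∀ {c a b} → c ℕ.+ a ≡ 2 → a ℕ.+ b ≡ 3 →
  a · cliqueCoeff (suc c) + b · cliqueCoeff c ≡ δ c 2
cliqueCoeff-balance {0}                 refl refl = refl
cliqueCoeff-balance {1}                 refl refl = refl
cliqueCoeff-balance {2}                 refl refl = refl
cliqueCoeff-balance {suc (suc (suc _))} ()   _

cliqueWeight : Subset n → Subset n → Subset n → ℚ
cliqueWeight p K e = if does (e ⊆? K) then cliqueCoeff ∣ p ∩ e ∣ else 0ℚ

cliqueWeight-⊆ : ∀ p → e ⊆ K → cliqueWeight p K e ≡ cliqueCoeff ∣ p ∩ e ∣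
cliqueWeight-⊆ {e = e} {K = K} p e⊆K = cong (if_then cliqueCoeff ∣ p ∩ e ∣ else 0ℚ) (dec-true (e ⊆? K) e⊆K)

cliqueWeight-⊈ : ∀ p → ¬ e ⊆ K → cliqueWeight p K e ≡ 0ℚ
cliqueWeight-⊈ {e = e} {K = K} p e⊈K = cong (if_then cliqueCoeff ∣ p ∩ e ∣ else 0ℚ) (dec-false (e ⊆? K) e⊈K)

module _ (H : Hypergraph3 n) where

  edgesContaining : Subset n → List (Subset n)
  edgesContaining q = filter (q ⊆?_) (edges H)

  sumℚ-edgesContaining-K₅ : InK5 H K → ∣ q ∣ ≡ 2 → q ⊆ K →
    {F : Subset n → ℚ} → (∀ {e} → ¬ e ⊆ K → F e ≡ 0ℚ) →
    sumℚ (map F (edgesContaining q)) ≡ sumOver (K ─ q) (λ x → F (q ∪ ⁅ x ⁆))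
  sumℚ-edgesContaining-K₅ {K = K} {q = q} (_ , K-complete) ∣q∣≡2 q⊆K {F} F-off =
    sumℚ-reindex (≡-dec Bool._≟_) (K ─ q) (λ x → q ∪ ⁅ x ⁆) (filter⁺ (q ⊆?_) (unique H))
      ∪⁅⁆-injective ∪⁅⁆∈edges vanish
    where
    ∣q∪⁅x⁆∣≡3 : x ∉ₛ q → ∣ q ∪ ⁅ x ⁆ ∣ ≡ 3
    ∣q∪⁅x⁆∣≡3 x∉q = trans (x∉p⇒∣p∪⁅x⁆∣≡1+∣p∣ x∉q) (cong suc ∣q∣≡2)

    ∪⁅⁆-injective : ∀ {x y} → x ∈ₛ K ─ q → y ∈ₛ K ─ q → q ∪ ⁅ x ⁆ ≡ q ∪ ⁅ y ⁆ → x ≡ y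
    ∪⁅⁆-injective {x} {y} x∈K─q _ eq = [ ⊥-elim ∘ x∈p─q⇒x∉q x∈K─q , x∈⁅y⁆⇒x≡y y ]
      (x∈p∪q⁻ q ⁅ y ⁆ (subst (x ∈ₛ_) eq (q⊆p∪q q ⁅ x ⁆ (x∈⁅x⁆ x))))

    ∪⁅⁆∈edges : ∀ {x} → x ∈ₛ K ─ q → q ∪ ⁅ x ⁆ ∈ edgesContaining q
    ∪⁅⁆∈edges {x} x∈K─q = ∈-filter⁺ (q ⊆?_)
      (K-complete _ (∪⁅⁆-⊆ q⊆K (p─q⊆p K q x∈K─q)) (∣q∪⁅x⁆∣≡3 (x∈p─q⇒x∉q x∈K─q)))
      (p⊆p∪q ⁅ x ⁆)

    vanish : ∀ {e} → e ∈ edgesContaining q → (∀ {x} → x ∈ₛ K ─ q → e ≢ q ∪ ⁅ x ⁆) → F e ≡ 0ℚ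
    vanish e∈ e∉image with ∈-filter⁻ (q ⊆?_) e∈
    ... | e∈H , q⊆e
      with p⊆q∧∣q∣≡1+∣p∣⇒q≡p∪⁅x⁆ q⊆e (trans (All.lookup (uniform H) e∈H) (cong suc (sym ∣q∣≡2)))
    ... | x , x∉q , x∈e , e≡q∪⁅x⁆ = F-off λ e⊆K → e∉image (x∈p∧x∉q⇒x∈p─q (e⊆K x∈e) x∉q) e≡q∪⁅x⁆

  deg-cliqueWeight : p ⊆ K → InK5 H K → ∣ p ∣ ≡ 2 → ∣ q ∣ ≡ 2 → q ⊆ K →
    deg H (cliqueWeight p K) q ≡ δ ∣ p ∩ q ∣ 2
  deg-cliqueWeight {p = p} {K = K} {q = q} p⊆K K∈K₅ ∣p∣≡2 ∣q∣≡2 q⊆K = begin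
    deg H (cliqueWeight p K) q
      ≡⟨ sumℚ-edgesContaining-K₅ K∈K₅ ∣q∣≡2 q⊆K (cliqueWeight-⊈ p) ⟩
    sumOver (K ─ q) (λ x → cliqueWeight p K (q ∪ ⁅ x ⁆))
      ≡⟨ sumOver-two-valued (K ─ q) p on-p off-p ⟩
    ∣ (K ─ q) ∩ p ∣ · cliqueCoeff (suc c) + ∣ (K ─ q) ─ p ∣ · cliqueCoeff c
      ≡⟨ cliqueCoeff-balance {c} c+a≡2 a+b≡3 ⟩
    δ c 2
      ∎
    where
    c = ∣ p ∩ q ∣

    cliqueWeight-∪⁅⁆ : ∀ {x} → x ∈ₛ K ─ q → cliqueWeight p K (q ∪ ⁅ x ⁆) ≡ cliqueCoeff ∣ p ∩ (q ∪ ⁅ x ⁆) ∣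
    cliqueWeight-∪⁅⁆ x∈K─q = cliqueWeight-⊆ p (∪⁅⁆-⊆ q⊆K (p─q⊆p K q x∈K─q))

    on-p : ∀ {x} → x ∈ₛ K ─ q → x ∈ₛ p → cliqueWeight p K (q ∪ ⁅ x ⁆) ≡ cliqueCoeff (suc c)
    on-p x∈K─q x∈p = trans (cliqueWeight-∪⁅⁆ x∈K─q)
      (cong cliqueCoeff (x∈p∧x∉q⇒∣p∩[q∪⁅x⁆]∣≡1+∣p∩q∣ x∈p (x∈p─q⇒x∉q x∈K─q)))

    off-p : ∀ {x} → x ∈ₛ K ─ q → x ∉ₛ p → cliqueWeight p K (q ∪ ⁅ x ⁆) ≡ cliqueCoeff c
    off-p x∈K─q x∉p = trans (cliqueWeight-∪⁅⁆ x∈K─q) (cong cliqueCoeff (x∉p⇒∣p∩[q∪⁅x⁆]∣≡∣p∩q∣ x∉p))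

    c+a≡2 : c ℕ.+ ∣ (K ─ q) ∩ p ∣ ≡ 2
    c+a≡2 = begin
      c ℕ.+ ∣ (K ─ q) ∩ p ∣  ≡⟨ cong (λ r → c ℕ.+ ∣ r ∣) (p⊆r⇒[r─q]∩p≡p─q p⊆K) ⟩
      c ℕ.+ ∣ p ─ q ∣        ≡⟨ ∣p∩q∣+∣p─q∣≡∣p∣ p q ⟩
      ∣ p ∣                  ≡⟨ ∣p∣≡2 ⟩
      2                      ∎

    ∣K─q∣≡3 : ∣ K ─ q ∣ ≡ 3
    ∣K─q∣≡3 = ℕ.+-cancelˡ-≡ 2 _ _ (begin
      2 ℕ.+ ∣ K ─ q ∣          ≡⟨ cong (ℕ._+ ∣ K ─ q ∣) ∣q∣≡2 ⟨
      ∣ q ∣ ℕ.+ ∣ K ─ q ∣      ≡⟨ cong (λ r → ∣ r ∣ ℕ.+ ∣ K ─ q ∣) (q⊆p⇒p∩q≡q q⊆K) ⟨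
      ∣ K ∩ q ∣ ℕ.+ ∣ K ─ q ∣  ≡⟨ ∣p∩q∣+∣p─q∣≡∣p∣ K q ⟩
      ∣ K ∣                    ≡⟨ proj₁ K∈K₅ ⟩
      5                        ∎)

    a+b≡3 : ∣ (K ─ q) ∩ p ∣ ℕ.+ ∣ (K ─ q) ─ p ∣ ≡ 3
    a+b≡3 = trans (∣p∩q∣+∣p─q∣≡∣p∣ (K ─ q) p) ∣K─q∣≡3

  deg-cliqueWeight-self : p ⊆ K → InK5 H K → ∣ p ∣ ≡ 2 → deg H (cliqueWeight p K) p ≡ 1ℚ
  deg-cliqueWeight-self {p = p} p⊆K K∈K₅ ∣p∣≡2 = trans (deg-cliqueWeight p⊆K K∈K₅ ∣p∣≡2 ∣p∣≡2 p⊆K)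
    (cong (λ c → δ c 2) (trans (cong ∣_∣ (∩-idem p)) ∣p∣≡2))

  deg-cliqueWeight-other : p ⊆ K → InK5 H K → ∣ p ∣ ≡ 2 → ∣ q ∣ ≡ 2 → p ≢ q →
    deg H (cliqueWeight p K) q ≡ 0ℚ
  deg-cliqueWeight-other {p = p} {K = K} {q = q} p⊆K K∈K₅ ∣p∣≡2 ∣q∣≡2 p≢q with q ⊆? K
  ... | yes q⊆K = trans (deg-cliqueWeight p⊆K K∈K₅ ∣p∣≡2 ∣q∣≡2 q⊆K) (δ-≢ ∣p∩q∣≢2)
    where
    ∣p∩q∣≢2 : ∣ p ∩ q ∣ ≢ 2
    ∣p∩q∣≢2 ∣p∩q∣≡2 = p≢q (begin
      p      ≡⟨ p⊆q∧∣p∣≡∣q∣⇒p≡q (p∩q⊆p p q) (trans ∣p∩q∣≡2 (sym ∣p∣≡2)) ⟨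
      p ∩ q  ≡⟨ p⊆q∧∣p∣≡∣q∣⇒p≡q (p∩q⊆q p q) (trans ∣p∩q∣≡2 (sym ∣q∣≡2)) ⟩
      q      ∎)
  ... | no q⊈K = sumℚ-zero λ e∈ →
    cliqueWeight-⊈ p λ e⊆K → q⊈K (e⊆K ∘ proj₂ (∈-filter⁻ (q ⊆?_) {xs = edges H} e∈))

module _ (H : Hypergraph3 n) (K₅-cover : ∀ p → InShadow H p → ∃[ K ] (InK5 H K × p ⊆ K)) where

  inShadow? : (p : Subset n) → Dec (InShadow H p)
  inShadow? p = (∣ p ∣ ℕ.≟ 2) ×-dec map′ find (λ (e , e∈H , p⊆e) → lose e∈H p⊆e) (any? (p ⊆?_) (edges H))

  pairWeight : (p : Subset n) → Dec (InShadow H p) → Subset n → ℚ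
  pairWeight p (yes p∈∂H) = cliqueWeight p (proj₁ (K₅-cover p p∈∂H))
  pairWeight p (no _)     = λ _ → 0ℚ

  deg-pairWeight-self : InShadow H q → (q∈∂H? : Dec (InShadow H q)) →
    deg H (pairWeight q q∈∂H?) q ≡ 1ℚ
  deg-pairWeight-self q∈∂H (no q∉∂H) = ⊥-elim (q∉∂H q∈∂H)
  deg-pairWeight-self {q = q} _ (yes q∈∂H) =
    let K , K∈K₅ , q⊆K = K₅-cover q q∈∂H in deg-cliqueWeight-self H q⊆K K∈K₅ (proj₁ q∈∂H)

  deg-pairWeight-other : ∣ q ∣ ≡ 2 → p ≢ q → (p∈∂H? : Dec (InShadow H p)) →
    deg H (pairWeight p p∈∂H?) q ≡ 0ℚ
  deg-pairWeight-other {q = q} ∣q∣≡2 p≢q (no _) = sumℚ-zero {L = edgesContaining H q} λ _ → refl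
  deg-pairWeight-other {p = p} ∣q∣≡2 p≢q (yes p∈∂H) =
    let K , K∈K₅ , p⊆K = K₅-cover p p∈∂H in deg-cliqueWeight-other H p⊆K K∈K₅ (proj₁ p∈∂H) ∣q∣≡2 p≢q

  weight : Subset n → ℚ
  weight e = sumSubsets λ p → pairWeight p (inShadow? p) e

  deg-weight : InShadow H q → deg H weight q ≡ 1ℚ
  deg-weight {q = q} q∈∂H = begin
    deg H weight q
      ≡⟨ sumℚ-sumSubsets-comm (λ p → pairWeight p (inShadow? p)) (edgesContaining H q) ⟩
    sumSubsets (λ p → deg H (pairWeight p (inShadow? p)) q)
      ≡⟨ sumSubsets-single q (λ p p≢q → deg-pairWeight-other (proj₁ q∈∂H) p≢q (inShadow? p)) ⟩
    deg H (pairWeight q (inShadow? q)) q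
      ≡⟨ deg-pairWeight-self q∈∂H (inShadow? q) ⟩
    1ℚ ∎

corollary2p3 : (n : ℕ) (H : Hypergraph3 n) →
    (∀ p → InShadow H p → ∃[ K ] (InK5 H K × p ⊆ K)) →
    ∃[ w ] (∀ (p : Subset n) → InShadow H p → deg H w p ≡ 1ℚ)
corollary2p3 n H K₅-cover = weight H K₅-cover , λ _ → deg-weight H K₅-cover
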